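{- For every integer $k\ge 2$, $T_k(k+2)=k+3$. Moreover, up to isomorphism the star $K_{1,k+1}$ is the unique extremal graph, i.e. the unique triangle-free graph on $k+2$ vertices containing no $k$-sparse set of $k+2$ vertices.
   Context: All graphs are finite and simple. A set $S$ of vertices of a graph $G$ is $k$-sparse if the induced subgraph $G[S]$ has maximum degree at most $k$. For integers $k\ge0$ and $j\ge1$, $T_k(j)$ denotes the minimum $n$ such that every triangle-free graph on $n$ vertices contains a $k$-sparse set of $j$ vertices. An extremal graph for $T_k(j)$ is a triangle-free graph on $T_k(j)-1$ vertices containing no $k$-sparse set of $j$ vertices. -}

module Defs where

open import Data.Nat using (ℕ; suc; _≤_; _<_)
open import Data.Bool using (Bool; true; false; _xor_)
open import Data.Fin using (Fin; zero; suc)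
open import Data.Fin.Subset using (Subset; _∈_; _∩_; ∣_∣)
open import Data.Fin.Permutation using (Permutation′; _⟨$⟩ʳ_)
open import Data.Vec using (tabulate)
open import Data.Product using (Σ; _×_)
open import Data.Empty using (⊥)
open import Relation.Nullary using (¬_)
open import Relation.Binary.PropositionalEquality using (_≡_)

record Graph (n : ℕ) : Set where
  field
    adj     : Fin n → Fin n → Bool
    adj-sym : ∀ u v → adj u v ≡ adj v u
    irrefl  : ∀ v → adj v v ≡ false
open Graph public

TriangleFree : ∀ {n} → Graph n → Set
TriangleFree G = ∀ a b c → adj G a b ≡ true → adj G b c ≡ true → adj G a c ≡ true → ⊥

N : ∀ {n} → Graph n → Fin n → Subset n
N G v = tabulate (adj G v)

Sparse : ∀ {n} → Graph n → ℕ → Subset n → Set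
Sparse G k S = ∀ v → v ∈ S → ∣ N G v ∩ S ∣ ≤ k

HasSparse : ∀ {n} → Graph n → ℕ → ℕ → Set
HasSparse {n} G k j = Σ (Subset n) (λ S → ∣ S ∣ ≡ j × Sparse G k S)

Forces : ℕ → ℕ → ℕ → Set
Forces k j n = ∀ (G : Graph n) → TriangleFree G → HasSparse G k j

-- m = T_k(j): m is the minimum n with Forces k j n
IsT : ℕ → ℕ → ℕ → Set
IsT k j m = Forces k j m × (∀ n → n < m → ¬ Forces k j n)

-- extremal graph for T_k(j) (on T_k(j) - 1 = n vertices)
Extremal : ∀ {n} → ℕ → ℕ → Graph n → Set
Extremal k j G = TriangleFree G × ¬ HasSparse G k j

starAdj : ∀ {m} → Fin (suc m) → Fin (suc m) → Bool
starAdj zero    zero    = false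
starAdj zero    (suc _) = true
starAdj (suc _) zero    = true
starAdj (suc _) (suc _) = false

starAdj-sym : ∀ {m} (u v : Fin (suc m)) → starAdj u v ≡ starAdj v u
starAdj-sym zero    zero    = _≡_.refl
starAdj-sym zero    (suc _) = _≡_.refl
starAdj-sym (suc _) zero    = _≡_.refl
starAdj-sym (suc _) (suc _) = _≡_.refl

starAdj-irr : ∀ {m} (v : Fin (suc m)) → starAdj v v ≡ false
starAdj-irr zero    = _≡_.refl
starAdj-irr (suc _) = _≡_.refl

Star : (m : ℕ) → Graph (suc m)
Star m = record { adj = starAdj ; adj-sym = starAdj-sym ; irrefl = starAdj-irr }

_≅_ : ∀ {n} → Graph n → Graph n → Set
_≅_ {n} G H = Σ (Permutation′ n) (λ σ → ∀ u v → adj G u v ≡ adj H (σ ⟨$⟩ʳ u) (σ ⟨$⟩ʳ v))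

{-# OPTIONS --safe #-}
-- Let G be triangle-free on k + 3 ≥ 5 vertices. If no set V ∖ {w} is k-sparse, then for every w
-- some b ≠ w has k + 1 neighbours in V ∖ {w}, i.e. b is adjacent to everything except b and w.
-- Two adjacent such vertices would have a common neighbour outside the four vertices involved,
-- so two distinct such vertices must be each other's exceptions. Then w₀ and its b₀ form such a
-- pair, and a vertex c ∉ {w₀, b₀} has no such b. On k + 2 vertices the only candidate set is V,
-- so an extremal graph has a vertex adjacent to all others, and triangle-freeness makes it a star.
module Submission where

open import Defs
open import Data.Nat using (ℕ; suc; _≤_; _<_; _+_; _∸_; s≤s; _<?_; z≤n)
open import Data.Nat.Properties
  using (≤-trans; ≤-pred; +-suc; +-comm; +-monoˡ-≤; +-monoʳ-≤; +-monoʳ-<; <-irrefl; ≮⇒≥; <⇒≱; m<m+n; m≤n⇒m<n∨m≡n; module ≤-Reasoning)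
open import Data.Product using (_×_; ∃; _,_)
open import Data.Sum using (_⊎_; inj₁; inj₂; [_,_]′)
open import Data.Bool using (true; false; _xor_)
open import Data.Empty using (⊥-elim)
open import Data.Fin using (Fin; zero; suc; _≟_)
open import Data.Fin.Properties using (any?; pigeonhole; <⇒≢)
open import Data.Fin.Subset using (Subset; _∈_; _∩_; _⊆_; _-_; ∣_∣; ⊤; ⁅_⁆; ∁)
open import Data.Fin.Subset.Properties
  using (_∈?_; ∈⊤; x∈p∩q⁻; x∈p∧x≢y⇒x∈p-y; x∈p⇒∣p-x∣<∣p∣; p⊆q⇒∣p∣≤∣q∣; x∈∁p⇒x∉p; x∉p⇒x∈∁p;
         x≢y⇒x∉⁅y⁆; x∉⁅y⁆⇒x≢y; ∣p∣≤n; ∣⊤∣≡n; ∣p∣≡n⇒p≡⊤; ∣∁p∣≡n∸∣p∣; ∣⁅x⁆∣≡1; ∩-identityʳ)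
open import Data.Fin.Permutation using (Permutation; _⟨$⟩ʳ_; _⟨$⟩ˡ_; inverseˡ; transpose)
open import Data.Vec.Properties using ([]=⇒lookup; lookup∘tabulate)
open import Data.List using (List; []; _∷_; length; lookup)
open import Data.List.Relation.Unary.All using (All; []; _∷_)
open import Data.List.Relation.Unary.All.Properties using (¬Any⇒All¬)
open import Data.List.Relation.Unary.Any as Any using (Any; index)
open import Data.List.Relation.Unary.Any.Properties using (lookup-index)
open import Function using (_∘_; _⇔_; mk⇔)
open import Relation.Nullary using (¬_; yes; no; does; ¬?; _×-dec_; contradiction; decidable-stable)
open import Relation.Nullary.Decidable using (does-⇔; dec-true)
open import Relation.Binary.PropositionalEquality using (_≡_; _≢_; refl; sym; trans; cong; cong₂; subst; module ≡-Reasoning)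

covering⇒length≮n : ∀ {n} {xs : List (Fin n)} → (∀ x → Any (x ≡_) xs) → ¬ length xs < n
covering⇒length≮n {xs = xs} covers short with pigeonhole short (index ∘ covers)
... | i , j , i<j , same = <⇒≢ i<j (begin
  i                               ≡⟨ lookup-index (covers i) ⟩
  lookup xs (index (covers i))    ≡⟨ cong (lookup xs) same ⟩
  lookup xs (index (covers j))    ≡⟨ lookup-index (covers j) ⟨
  j                               ∎)
  where open ≡-Reasoning

fresh : ∀ {n} (xs : List (Fin n)) → length xs < n → ∃ λ x → All (x ≢_) xs
fresh xs short with any? (λ x → ¬? (Any.any? (x ≟_) xs))
... | yes (x , x∉xs) = x , ¬Any⇒All¬ xs x∉xs
... | no ¬fresh = contradiction short (covering⇒length≮n λ x →
        decidable-stable (Any.any? (x ≟_) xs) (λ x∉xs → ¬fresh (x , x∉xs)))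

∣∁⁅x⁆∣≡n∸1 : ∀ {n} (x : Fin n) → ∣ ∁ ⁅ x ⁆ ∣ ≡ n ∸ 1
∣∁⁅x⁆∣≡n∸1 {n} x = trans (∣∁p∣≡n∸∣p∣ ⁅ x ⁆) (cong (n ∸_) (∣⁅x⁆∣≡1 x))

∀⊎⇒∃⊎∀ : ∀ {n} {A B : Fin n → Set} → (∀ i → A i ⊎ B i) → ∃ A ⊎ (∀ i → B i)
∀⊎⇒∃⊎∀ {ℕ.zero} _ = inj₂ λ ()
∀⊎⇒∃⊎∀ {suc n} a⊎b with a⊎b zero | ∀⊎⇒∃⊎∀ (a⊎b ∘ suc)
... | inj₁ a | _             = inj₁ (zero , a)
... | inj₂ _ | inj₁ (i , a)  = inj₁ (suc i , a)
... | inj₂ b | inj₂ bs       = inj₂ λ { zero → b ; (suc i) → bs i }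

transpose-matchˡ : ∀ {n} (i j : Fin n) → transpose i j ⟨$⟩ʳ i ≡ j
transpose-matchˡ i j rewrite dec-true (i ≟ i) refl = refl

≡⇔⟨$⟩ʳ≡ : ∀ {m n} (σ : Permutation m n) {c d u} → σ ⟨$⟩ʳ c ≡ d → (u ≡ c ⇔ σ ⟨$⟩ʳ u ≡ d)
≡⇔⟨$⟩ʳ≡ σ {c} {d} {u} σc≡d = mk⇔ (λ { refl → σc≡d }) λ σu≡d → begin
  u                   ≡⟨ inverseˡ σ ⟨
  σ ⟨$⟩ˡ (σ ⟨$⟩ʳ u)   ≡⟨ cong (σ ⟨$⟩ˡ_) (trans σu≡d (sym σc≡d)) ⟩
  σ ⟨$⟩ˡ (σ ⟨$⟩ʳ c)   ≡⟨ inverseˡ σ ⟩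
  c                   ∎
  where open ≡-Reasoning

module _ {n} (G : Graph n) where

  ∈N⇒adj : ∀ {v x} → x ∈ N G v → adj G v x ≡ true
  ∈N⇒adj {v} {x} x∈Nv = trans (sym (lookup∘tabulate (adj G v) x)) ([]=⇒lookup x∈Nv)

  sparse-or-overfull : ∀ k U → Sparse G k U ⊎ ∃ λ b → b ∈ U × k < ∣ N G b ∩ U ∣
  sparse-or-overfull k U with any? (λ b → (b ∈? U) ×-dec (k <? ∣ N G b ∩ U ∣))
  ... | yes overfull = inj₂ overfull
  ... | no ¬overfull = inj₁ λ v v∈U → ≮⇒≥ (λ k<deg → ¬overfull (v , v∈U , k<deg))

  Dominates : Subset n → Fin n → Set
  Dominates U b = ∀ {x} → x ∈ U → x ≢ b → adj G b x ≡ true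

  overfull⇒dominates : ∀ {k U b} → ∣ U ∣ ≡ 2 + k → k < ∣ N G b ∩ U ∣ → b ∈ U → Dominates U b
  overfull⇒dominates {k} {U} {b} ∣U∣≡2+k k<deg b∈U {x} x∈U x≢b with adj G b x in bx
  ... | true  = refl
  ... | false = ⊥-elim (<-irrefl refl (begin-strict
    2 + k                  <⟨ +-monoʳ-< 2 k<deg ⟩
    2 + ∣ N G b ∩ U ∣      ≤⟨ +-monoʳ-≤ 2 (p⊆q⇒∣p∣≤∣q∣ Nb∩U⊆) ⟩
    2 + ∣ U - b - x ∣      ≤⟨ s≤s (x∈p⇒∣p-x∣<∣p∣ (x∈p∧x≢y⇒x∈p-y x∈U x≢b)) ⟩
    1 + ∣ U - b ∣          ≤⟨ x∈p⇒∣p-x∣<∣p∣ b∈U ⟩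
    ∣ U ∣                  ≡⟨ ∣U∣≡2+k ⟩
    2 + k                  ∎))
    where
    open ≤-Reasoning
    Nb∩U⊆ : N G b ∩ U ⊆ U - b - x
    Nb∩U⊆ {y} y∈Nb∩U with x∈p∩q⁻ (N G b) U y∈Nb∩U
    ... | y∈Nb , y∈U = x∈p∧x≢y⇒x∈p-y (x∈p∧x≢y⇒x∈p-y y∈U y≢b) y≢x
      where
      y≢b : y ≢ b
      y≢b refl with () ← trans (sym (∈N⇒adj y∈Nb)) (irrefl G y)
      y≢x : y ≢ x
      y≢x refl with () ← trans (sym (∈N⇒adj y∈Nb)) bx

  sparse-or-dominated : ∀ {k U} → ∣ U ∣ ≡ 2 + k → Sparse G k U ⊎ ∃ λ b → b ∈ U × Dominates U b
  sparse-or-dominated {k} {U} ∣U∣≡2+k with sparse-or-overfull k U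
  ... | inj₁ sparse               = inj₁ sparse
  ... | inj₂ (b , b∈U , k<deg)    = inj₂ (b , b∈U , overfull⇒dominates ∣U∣≡2+k k<deg b∈U)

  Universal : Fin n → Set
  Universal c = ∀ x → x ≢ c → adj G c x ≡ true

  UniversalExcept : Fin n → Fin n → Set
  UniversalExcept w b = b ≢ w × (∀ x → x ≢ b → x ≢ w → adj G b x ≡ true)

  dominates⇒universalExcept : ∀ {w b} → b ∈ ∁ ⁅ w ⁆ → Dominates (∁ ⁅ w ⁆) b → UniversalExcept w b
  dominates⇒universalExcept b∈ adj-b =
    x∉⁅y⁆⇒x≢y (x∈∁p⇒x∉p b∈) , λ x x≢b x≢w → adj-b (x∉p⇒x∈∁p (x≢y⇒x∉⁅y⁆ x≢w)) x≢b

module _ {n} {G : Graph n} (triangleFree : TriangleFree G) (5≤n : 5 ≤ n) where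

  universalExcept-exception : ∀ {w b w′ b′} → UniversalExcept G w b → UniversalExcept G w′ b′ → b′ ≢ b → b′ ≡ w
  universalExcept-exception {w} {b} {w′} {b′} (_ , adj-b) (_ , adj-b′) b′≢b with b′ ≟ w
  ... | yes b′≡w = b′≡w
  ... | no b′≢w with fresh (b ∷ w ∷ b′ ∷ w′ ∷ []) 5≤n
  ... | x , x≢b ∷ x≢w ∷ x≢b′ ∷ x≢w′ ∷ [] =
        ⊥-elim (triangleFree b b′ x (adj-b b′ b′≢b b′≢w) (adj-b′ x x≢b′ x≢w′) (adj-b x x≢b x≢w))

  ¬∀∃universalExcept : ¬ (∀ w → ∃ (UniversalExcept G w))
  ¬∀∃universalExcept u with fresh [] (≤-trans (s≤s z≤n) 5≤n)
  ... | w₀ , _ with u w₀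
  ... | b₀ , u₀@(b₀≢w₀ , _) with u b₀
  ... | b₁ , u₁@(b₁≢b₀ , _) with universalExcept-exception u₀ u₁ b₁≢b₀
  ... | refl with fresh (w₀ ∷ b₀ ∷ []) (≤-trans (s≤s (s≤s (s≤s z≤n))) 5≤n)
  ... | c , c≢w₀ ∷ c≢b₀ ∷ [] with u c
  ... | b₂ , u₂ with b₂ ≟ b₀
  ... | yes refl = c≢w₀ (sym (universalExcept-exception u₂ u₁ (b₀≢w₀ ∘ sym)))
  ... | no b₂≢b₀ with universalExcept-exception u₀ u₂ b₂≢b₀
  ... | refl = c≢b₀ (sym (universalExcept-exception u₂ u₀ b₀≢w₀))

forces : ∀ k → 2 ≤ k → Forces k (k + 2) (k + 3)
forces k 2≤k G triangleFree = [ sparseSet , absurd ]′ (∀⊎⇒∃⊎∀ λ w → sparse-or-dominated G (∣∁⁅w⁆∣≡2+k w))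
  where
  ∣∁⁅w⁆∣≡2+k : ∀ w → ∣ ∁ ⁅ w ⁆ ∣ ≡ 2 + k
  ∣∁⁅w⁆∣≡2+k w = trans (∣∁⁅x⁆∣≡n∸1 w) (cong (_∸ 1) (+-comm k 3))
  sparseSet : (∃ λ w → Sparse G k (∁ ⁅ w ⁆)) → HasSparse G k (k + 2)
  sparseSet (w , sparse) = ∁ ⁅ w ⁆ , trans (∣∁⁅w⁆∣≡2+k w) (+-comm 2 k) , sparse
  absurd : (∀ w → ∃ λ b → b ∈ ∁ ⁅ w ⁆ × Dominates G (∁ ⁅ w ⁆) b) → HasSparse G k (k + 2)
  absurd dominated = ⊥-elim (¬∀∃universalExcept {G = G} triangleFree (+-monoˡ-≤ 3 2≤k) λ w →
    let b , b∈ , adj-b = dominated w in b , dominates⇒universalExcept G b∈ adj-b)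

emptyGraph : ∀ n → Graph n
emptyGraph n = record { adj = λ _ _ → false ; adj-sym = λ _ _ → refl ; irrefl = λ _ → refl }

forces⇒≤ : ∀ {k j n} → Forces k j n → j ≤ n
forces⇒≤ {n = n} F with F (emptyGraph n) (λ _ _ _ ())
... | S , ∣S∣≡j , _ = subst (_≤ n) ∣S∣≡j (∣p∣≤n S)

extremal⇒¬Forces : ∀ {k j n} {G : Graph n} → Extremal k j G → ¬ Forces k j n
extremal⇒¬Forces {G = G} (triangleFree , ¬sparse) F = ¬sparse (F G triangleFree)

adj-universal : ∀ {n} {G : Graph n} {c} → TriangleFree G → Universal G c →
  ∀ u w → adj G u w ≡ does (u ≟ c) xor does (w ≟ c)
adj-universal {G = G} {c} triangleFree universal u w with u ≟ c | w ≟ c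
... | yes refl | yes refl = irrefl G u
... | yes refl | no w≢c   = universal w w≢c
... | no u≢c   | yes refl = trans (adj-sym G u w) (universal u u≢c)
... | no u≢c   | no w≢c with adj G u w in uw
...   | false = refl
...   | true  = ⊥-elim (triangleFree c u w (universal u u≢c) uw (universal w w≢c))

universal-≅ : ∀ {n} {G H : Graph n} {c d} → TriangleFree G → Universal G c → TriangleFree H → Universal H d → G ≅ H
universal-≅ {G = G} {H} {c} {d} triangleFreeG universalG triangleFreeH universalH = σ , λ u w → begin
  adj G u w                                      ≡⟨ adj-universal {G = G} triangleFreeG universalG u w ⟩
  does (u ≟ c) xor does (w ≟ c)                  ≡⟨ cong₂ _xor_ (does-≟ u) (does-≟ w) ⟩
  does (σ ⟨$⟩ʳ u ≟ d) xor does (σ ⟨$⟩ʳ w ≟ d)    ≡⟨ adj-universal {G = H} triangleFreeH universalH (σ ⟨$⟩ʳ u) (σ ⟨$⟩ʳ w) ⟨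
  adj H (σ ⟨$⟩ʳ u) (σ ⟨$⟩ʳ w)                    ∎
  where
  open ≡-Reasoning
  σ = transpose c d
  does-≟ : ∀ u → does (u ≟ c) ≡ does (σ ⟨$⟩ʳ u ≟ d)
  does-≟ u = does-⇔ (≡⇔⟨$⟩ʳ≡ σ (transpose-matchˡ c d)) (u ≟ c) (σ ⟨$⟩ʳ u ≟ d)

star-triangleFree : ∀ {m} → TriangleFree (Star m)
star-triangleFree zero    zero    _       ()
star-triangleFree zero    (suc _) zero    _  _  ()
star-triangleFree zero    (suc _) (suc _) _  ()
star-triangleFree (suc _) zero    zero    _  ()
star-triangleFree (suc _) zero    (suc _) _  _  ()
star-triangleFree (suc _) (suc _) _       ()

star-universal : ∀ {m} → Universal (Star m) zero
star-universal zero    0≢0 = contradiction refl 0≢0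
star-universal (suc _) _   = refl

∣N-centre∣ : ∀ m → ∣ N (Star m) zero ∣ ≡ m
∣N-centre∣ ℕ.zero = refl
∣N-centre∣ (suc m) = cong suc (∣N-centre∣ m)

star-¬HasSparse : ∀ {k m} → k < m → ¬ HasSparse (Star m) k (suc m)
star-¬HasSparse {k} {m} k<m (S , ∣S∣≡1+m , sparse) with ∣p∣≡n⇒p≡⊤ {p = S} ∣S∣≡1+m
... | refl = <⇒≱ k<m (subst (_≤ k) (trans (cong ∣_∣ (∩-identityʳ (N (Star m) zero))) (∣N-centre∣ m)) (sparse zero ∈⊤))

star-extremal : ∀ k → Extremal k (k + 2) (Star (k + 1))
star-extremal k = star-triangleFree ,
  subst (λ j → ¬ HasSparse (Star (k + 1)) k j) (sym (+-suc k 1)) (star-¬HasSparse (m<m+n k (s≤s z≤n)))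

extremal⇒≅Star : ∀ k (G : Graph (suc (k + 1))) → Extremal k (k + 2) G → G ≅ Star (k + 1)
extremal⇒≅Star k G (triangleFree , ¬sparse) with sparse-or-dominated G (trans (∣⊤∣≡n _) (cong suc (+-comm k 1)))
... | inj₁ sparse          = ⊥-elim (¬sparse (⊤ , trans (∣⊤∣≡n _) (sym (+-suc k 1)) , sparse))
... | inj₂ (c , _ , adj-c) = universal-≅ {G = G} {H = Star (k + 1)} triangleFree (λ x x≢c → adj-c ∈⊤ x≢c) star-triangleFree star-universal

T-k+2≡k+3 : ∀ k → 2 ≤ k → IsT k (k + 2) (k + 3)
T-k+2≡k+3 k 2≤k = forces k 2≤k , ¬forces
  where
  ¬forces : ∀ n → n < k + 3 → ¬ Forces k (k + 2) n
  ¬forces n n<k+3 F with m≤n⇒m<n∨m≡n (≤-pred (subst (n <_) (+-suc k 2) n<k+3))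
  ... | inj₁ n<k+2 = <⇒≱ n<k+2 (forces⇒≤ F)
  ... | inj₂ refl  = extremal⇒¬Forces {G = Star (k + 1)} (star-extremal k) (subst (Forces k (k + 2)) (+-suc k 1) F)

theorem3p3 : ∀ (k : ℕ) → 2 ≤ k →
    IsT k (k + 2) (k + 3)
    × Extremal k (k + 2) (Star (k + 1))
    × (∀ (G : Graph (suc (k + 1))) → Extremal k (k + 2) G → G ≅ Star (k + 1))
theorem3p3 k 2≤k = T-k+2≡k+3 k 2≤k , star-extremal k , extremal⇒≅Star k
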